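{- Let $G$ be any multigraph in the support of the hard input distribution (with parameters $\epsilon, N, r, t, k, n, \alpha$), let $M^*$ be a maximum matching in $G$ and let $M$ be any trivial matching of $G$. Then $\frac{|M|}{|M^*|}\le \frac{4}{\alpha}$.
   Context: An $(r,t)$-Ruzsa–Szemerédi (RS) graph is a graph whose edge set is the disjoint union of $t$ induced matchings $M_1,\dots,M_t$, each of size $r$ (a matching $F$ is induced if no two of its edges share an endpoint and the only edges of the graph among the vertices covered by $F$ are those of $F$). Hard input distribution: let $\epsilon>0$, $N$ a sufficiently large integer, and $r,t$ with $r=N^{1-o(1)}$, $rt=\binom{N}{2}-o(N^2)$ such that an $(r,t)$-RS graph on $N$ vertices exists; let $k=(N^{1+\epsilon}/r)^{1/(1-\epsilon)}$, $n=kN$, $\alpha=n^{\epsilon}$ (so $k=\alpha N/r$). For each player $P_i$, $i\in[k]$, independently: take a set $V_i$ of $N$ vertices and an $(r,t)$-RS graph on $V_i$; pick $\lambda\in[t]$ uniformly at random and let $V_i^*$ be the $2r$ vertices matched by the induced matching $M_\lambda$; from each of the $t$ induced matchings drop half of the edges uniformly at random; call the result $G_i$. Then pick a uniformly random permutation $\pi$ of $[n]$ and label vertices: a vertex $v_j\in V_i\setminus V_i^*$ (the $j$-th vertex of $V_i$) gets label $\pi(j)$, the same for all players, while the vertices of $V_i^*$ get labels $\pi(m)$ for indices $m$ in a block of $2r$ indices in $\{N+1,\dots,n\}$ reserved for player $i$, different players' blocks being disjoint. Vertices with equal labels are identified, and $G$ is the resulting multigraph on $[n]$, the union of all $G_i$.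 A vertex of $G$ is good if it belongs to (is the label of a vertex of) $V_i^*$ for some $i\in[k]$. A matching of $G$ is trivial if the total number of good vertices matched by it is at most $N$. -}

module Defs where

open import Data.Nat using (ℕ; suc; _+_; _*_; _∸_; _/_; _≤_; _<_)
open import Data.Fin using (Fin; toℕ)
open import Data.Fin.Subset using (Subset; ∣_∣) renaming (_∈_ to _∈ₛ_)
open import Data.Product using (_×_; _,_; proj₁; proj₂; ∃; Σ)
open import Data.Sum using (_⊎_)
open import Data.List using (List; []; _∷_; concatMap; length)
open import Data.List.Relation.Unary.All using (All)
open import Data.List.Relation.Unary.Unique.Propositional using (Unique)
open import Data.List.Membership.Propositional using (_∈_)
open import Relation.Binary.PropositionalEquality using (_≡_; _≢_)
open import Relation.Nullary using (¬_)
open import Function.Bundles using (_⤖_; Bijection)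

-- Vertices of a graph on m vertices are Fin m (0-indexed: [m] = {0,…,m-1}).
-- An (undirected) edge is represented by an ordered pair of endpoints.
Edge : ℕ → Set
Edge m = Fin m × Fin m

SameEdge : ∀ {m} → Edge m → Edge m → Set
SameEdge (u , v) (x , y) = (u ≡ x × v ≡ y) ⊎ (u ≡ y × v ≡ x)

Touches : ∀ {m} → Fin m → Edge m → Set
Touches x (u , v) = x ≡ u ⊎ x ≡ v

CoveredBy : ∀ {N r t} → (Fin t → Fin r → Edge N) → Fin t → Fin N → Set
CoveredBy {r = r} e s x = ∃ λ (a : Fin r) → Touches x (e s a)

-- An (r,t)-Ruzsa–Szemerédi graph on vertex set Fin N: its edge set is the
-- disjoint union of the t matchings  M_s = { edge s a | a : Fin r }, each of size r
-- and each induced.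
record RSGraph (N r t : ℕ) : Set where
  field
    edge          : Fin t → Fin r → Edge N
    noLoop        : ∀ s a → proj₁ (edge s a) ≢ proj₂ (edge s a)
    matching      : ∀ s a b → a ≢ b → ∀ x → Touches x (edge s a) → ¬ Touches x (edge s b)
    disjointUnion : ∀ s a s' b → SameEdge (edge s a) (edge s' b) → (s ≡ s' × a ≡ b)
    induced       : ∀ s s' b → CoveredBy edge s (proj₁ (edge s' b))
                               → CoveredBy edge s (proj₂ (edge s' b)) → s' ≡ s

-- A point of the support of the hard input distribution with parameters N r t k
-- (n = k * N).  Player i : Fin k owns V_i = Fin N.
record HardInstance (N r t k : ℕ) : Set where
  field
    rs       : Fin k → RSGraph N r t
    chosen   : Fin k → Fin t
    -- kept i s = set of edges of M_s (of player i) that are NOT dropped;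
    -- exactly ⌊r/2⌋ edges are dropped from each matching
    kept     : Fin k → Fin t → Subset r
    keptSize : ∀ i s → ∣ kept i s ∣ ≡ r ∸ r / 2
    π        : Fin (k * N) ⤖ Fin (k * N)
    -- idx i j = the index m in [n] such that vertex j of player i gets label π(m)
    idx      : Fin k → Fin N → Fin (k * N)
    idx-nonstar : ∀ i j → ¬ CoveredBy (RSGraph.edge (rs i)) (chosen i) j
                  → toℕ (idx i j) ≡ toℕ j
    idx-star    : ∀ i j → CoveredBy (RSGraph.edge (rs i)) (chosen i) j
                  → (N + 2 * r * toℕ i ≤ toℕ (idx i j)) × (toℕ (idx i j) < N + 2 * r * suc (toℕ i))
    idx-star-inj : ∀ i j j' → CoveredBy (RSGraph.edge (rs i)) (chosen i) j
                   → CoveredBy (RSGraph.edge (rs i)) (chosen i) j' → idx i j ≡ idx i j' → j ≡ j'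

module _ {N r t k : ℕ} (H : HardInstance N r t k) where
  open HardInstance H

  Star : Fin k → Fin N → Set
  Star i j = CoveredBy (RSGraph.edge (rs i)) (chosen i) j

  label : Fin k → Fin N → Fin (k * N)
  label i j = Bijection.to π (idx i j)

  -- e is (an orientation of) an edge of the multigraph G = ⋃ G_i
  IsEdge : Edge (k * N) → Set
  IsEdge e = ∃ λ (i : Fin k) → ∃ λ (s : Fin t) → ∃ λ (a : Fin r) →
               (a ∈ₛ kept i s) ×
               SameEdge e (label i (proj₁ (RSGraph.edge (rs i) s a)) ,
                           label i (proj₂ (RSGraph.edge (rs i) s a)))

  Good : Fin (k * N) → Set
  Good x = ∃ λ (i : Fin k) → ∃ λ (j : Fin N) → Star i j × label i j ≡ x

  endpoints : List (Edge (k * N)) → List (Fin (k * N))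
  endpoints = concatMap (λ e → proj₁ e ∷ proj₂ e ∷ [])

  IsMatching : List (Edge (k * N)) → Set
  IsMatching M = All IsEdge M × Unique (endpoints M)

  IsMaximumMatching : List (Edge (k * N)) → Set
  IsMaximumMatching M = IsMatching M × (∀ M' → IsMatching M' → length M' ≤ length M)

  -- trivial: the number of good vertices matched by M is at most N
  -- (every duplicate-free list of good matched vertices has length ≤ N)
  IsTrivial : List (Edge (k * N)) → Set
  IsTrivial M = ∀ (L : List (Fin (k * N))) → Unique L
                → All (λ x → Good x × x ∈ endpoints M) L → length L ≤ N

module Submission where

-- Write α = k·r/N.  The claim |M| / |M*| ≤ 4/α is proved as two size bounds.
--
--  * A trivial matching M has |M| ≤ N.  Its 2|M| endpoints are distinct; at
--    most N of them are good (triviality), and a vertex that is not good is the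
--    label π(j) of a vertex j outside every V_i^*, so its π-preimage is < N and
--    by injectivity of π there are at most N of them as well.
--  * A maximum matching M* has |M*| ≥ k·⌈r/2⌉ ≥ k·r/2.  The kept halves of the
--    special induced matchings M_λ of the k players form a matching of G: their
--    endpoints are labelled injectively, because the players' V_i^* occupy
--    disjoint blocks of labels and inside one player M_λ is a matching.
--
-- Together: |M|·k·r ≤ N·k·r ≤ N·2|M*| ≤ 4·N·|M*|.

open import Defs
open import Data.Bool using (Bool; true; false)
open import Data.Empty using (⊥-elim)
open import Data.Fin using (Fin; toℕ) renaming (zero to fzero; suc to fsuc)
open import Data.Fin.Properties using (any?; toℕ-injective; toℕ<n) renaming (_≟_ to _≟ᶠ_; suc-injective to fsuc-injective)
open import Data.Fin.Subset using (Subset; ∣_∣) renaming (_∈_ to _∈ₛ_)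
import Data.Vec.Base as Vec
open import Data.List using (List; []; _∷_; length; map; filter; concatMap; upTo; allFin; _++_; cartesianProductWith)
open import Data.List.Properties using (length-map; length-upTo; length-++; length-tabulate; length-removeAt′)
open import Data.List.Relation.Unary.All as All using (All; []; _∷_)
import Data.List.Relation.Unary.All.Properties as AllP
open import Data.List.Relation.Unary.Any using (here; there; index; _─_)
open import Data.List.Relation.Unary.AllPairs using ([]; _∷_)
open import Data.List.Relation.Unary.Unique.Propositional using (Unique)
import Data.List.Relation.Unary.Unique.Propositional.Properties as Unique
open import Data.List.Membership.Propositional using (_∈_)
open import Data.List.Membership.Propositional.Properties using (∈-upTo⁺; ∈-map⁻; ∈-filter⁻; ∈-++⁻)
open import Data.Nat using (ℕ; suc; _+_; _*_; _∸_; _/_; _≤_; _<_; z≤n; s≤s)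
open import Data.Nat.Properties
  using (+-suc; *-suc; +-identityʳ; *-comm; *-assoc; *-commutativeSemigroup; <-cmp; <⇒≱; m∸n+n≡m; m+n≤o⇒m≤o∸n;
         +-mono-≤; +-monoʳ-≤; *-monoʳ-≤; *-monoˡ-≤; *-cancelˡ-≤; module ≤-Reasoning)
open import Data.Nat.DivMod using (m/n*n≤m; m/n≤m)
open import Algebra.Properties.CommutativeSemigroup *-commutativeSemigroup using (x∙yz≈y∙xz)
open import Data.Product using (_×_; _,_; proj₁; proj₂; ∃; ∃₂)
open import Data.Sum using (inj₁; inj₂)
open import Function.Bundles using (Bijection; module Surjection)
open import Relation.Binary.Definitions using (tri<; tri≈; tri>)
open import Relation.Binary.PropositionalEquality
  using (_≡_; _≢_; refl; sym; trans; cong; cong₂; subst; module ≡-Reasoning)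
open import Relation.Nullary using (¬_; Dec; yes; no)
open import Relation.Nullary.Decidable using (_×-dec_; _⊎-dec_)
open import Relation.Unary using (Pred; Decidable)
open import Relation.Unary.Properties using (∁?)

∈-─ : ∀ {A : Set} {x y : A} {ys : List A} (x∈ys : x ∈ ys) → y ∈ ys → x ≢ y → y ∈ (ys ─ x∈ys)
∈-─ (here refl) (here refl) x≢y = ⊥-elim (x≢y refl)
∈-─ (here refl) (there y∈ys) _ = y∈ys
∈-─ (there x∈ys) (here refl) _ = here refl
∈-─ (there x∈ys) (there y∈ys) x≢y = there (∈-─ x∈ys y∈ys x≢y)

unique-⊆-length : ∀ {A : Set} {xs ys : List A} → Unique xs → All (_∈ ys) xs → length xs ≤ length ys
unique-⊆-length {xs = []} _ _ = z≤n
unique-⊆-length {xs = x ∷ xs} {ys} (x∉xs ∷ xs-unique) (x∈ys ∷ xs⊆ys) = begin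
  suc (length xs)          ≤⟨ s≤s (unique-⊆-length xs-unique xs⊆ys─x) ⟩
  suc (length (ys ─ x∈ys)) ≡⟨ length-removeAt′ ys (index x∈ys) ⟨
  length ys                ∎
  where
  open ≤-Reasoning
  xs⊆ys─x : All (_∈ (ys ─ x∈ys)) xs
  xs⊆ys─x = All.zipWith (λ (x≢y , y∈ys) → ∈-─ x∈ys y∈ys x≢y) (x∉xs , xs⊆ys)

length-filter-split : ∀ {A : Set} {p} {P : Pred A p} (P? : Decidable P) (xs : List A)
  → length (filter P? xs) + length (filter (∁? P?) xs) ≡ length xs
length-filter-split P? [] = refl
length-filter-split P? (x ∷ xs) with P? x
... | yes _ = cong suc (length-filter-split P? xs)
... | no _ = trans (+-suc _ _) (cong suc (length-filter-split P? xs))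

pairs : ∀ {A B : Set} → List A → (A → List B) → List (A × B)
pairs [] ys = []
pairs (x ∷ xs) ys = map (x ,_) (ys x) ++ pairs xs ys

∈-pairs⁻ : ∀ {A B : Set} (xs : List A) {ys : A → List B} {x y}
  → (x , y) ∈ pairs xs ys → x ∈ xs × y ∈ ys x
∈-pairs⁻ (x ∷ xs) {ys} p∈ with ∈-++⁻ (map (x ,_) (ys x)) p∈
... | inj₁ p∈map with ∈-map⁻ (x ,_) p∈map
...   | _ , y∈ , refl = here refl , y∈
∈-pairs⁻ (x ∷ xs) p∈ | inj₂ p∈rest = let (x∈ , y∈) = ∈-pairs⁻ xs p∈rest in there x∈ , y∈

pairs-unique : ∀ {A B : Set} {xs : List A} {ys : A → List B}
  → Unique xs → (∀ x → Unique (ys x)) → Unique (pairs xs ys)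
pairs-unique {xs = []} _ _ = []
pairs-unique {xs = x ∷ xs} {ys} (x∉xs ∷ xs-unique) ys-unique =
  Unique.++⁺ (Unique.map⁺ ,-injectiveʳ (ys-unique x)) (pairs-unique xs-unique ys-unique) disjoint
  where
  ,-injectiveʳ : ∀ {y y'} → (x , y) ≡ (x , y') → y ≡ y'
  ,-injectiveʳ refl = refl
  disjoint : ∀ {p} → ¬ (p ∈ map (x ,_) (ys x) × p ∈ pairs xs ys)
  disjoint (p∈map , p∈rest) with ∈-map⁻ (x ,_) p∈map
  ... | _ , _ , refl = All.lookup x∉xs (proj₁ (∈-pairs⁻ xs p∈rest)) refl

length-pairs : ∀ {A B : Set} (xs : List A) {ys : A → List B} {c : ℕ}
  → (∀ x → length (ys x) ≡ c) → length (pairs xs ys) ≡ length xs * c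
length-pairs [] _ = refl
length-pairs (x ∷ xs) {ys} ys-length = begin
  length (map (x ,_) (ys x) ++ pairs xs ys)        ≡⟨ length-++ (map (x ,_) (ys x)) ⟩
  length (map (x ,_) (ys x)) + length (pairs xs ys) ≡⟨ cong₂ _+_ (trans (length-map _ (ys x)) (ys-length x))
                                                                 (length-pairs xs ys-length) ⟩
  _ + length xs * _                                 ∎
  where open ≡-Reasoning

elements : ∀ {n} → Subset n → List (Fin n)
elements Vec.[] = []
elements (true Vec.∷ p) = fzero ∷ map fsuc (elements p)
elements (false Vec.∷ p) = map fsuc (elements p)

length-elements : ∀ {n} (p : Subset n) → length (elements p) ≡ ∣ p ∣
length-elements Vec.[] = refl
length-elements (true Vec.∷ p) = cong suc (trans (length-map fsuc (elements p)) (length-elements p))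
length-elements (false Vec.∷ p) = trans (length-map fsuc (elements p)) (length-elements p)

∈-elements⁻ : ∀ {n} (p : Subset n) {a} → a ∈ elements p → a ∈ₛ p
∈-elements⁻ (true Vec.∷ p) (here refl) = Vec.here
∈-elements⁻ (true Vec.∷ p) (there a∈) with ∈-map⁻ fsuc a∈
... | _ , a∈p , refl = Vec.there (∈-elements⁻ p a∈p)
∈-elements⁻ (false Vec.∷ p) a∈ with ∈-map⁻ fsuc a∈
... | _ , a∈p , refl = Vec.there (∈-elements⁻ p a∈p)

elements-unique : ∀ {n} (p : Subset n) → Unique (elements p)
elements-unique Vec.[] = []
elements-unique (true Vec.∷ p) = All.tabulate zero∉ ∷ Unique.map⁺ fsuc-injective (elements-unique p)
  where
  zero∉ : ∀ {y} → y ∈ map fsuc (elements p) → fzero ≢ y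
  zero∉ y∈ with ∈-map⁻ fsuc y∈
  zero∉ y∈ | _ , _ , refl = λ ()
elements-unique (false Vec.∷ p) = Unique.map⁺ fsuc-injective (elements-unique p)

endpointList : ∀ {n} → List (Edge n) → List (Fin n)
endpointList = concatMap (λ e → proj₁ e ∷ proj₂ e ∷ [])

length-endpointList : ∀ {n} (M : List (Edge n)) → length (endpointList M) ≡ 2 * length M
length-endpointList [] = refl
length-endpointList (e ∷ M) = trans (cong (2 +_) (length-endpointList M)) (sym (*-suc 2 (length M)))

∈-endpointList⁻ : ∀ {n} (M : List (Edge n)) {x} → x ∈ endpointList M → ∃ λ e → e ∈ M × Touches x e
∈-endpointList⁻ (e ∷ M) (here x≡u) = e , here refl , inj₁ x≡u
∈-endpointList⁻ (e ∷ M) (there (here x≡v)) = e , here refl , inj₂ x≡v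
∈-endpointList⁻ (e ∷ M) (there (there x∈)) =
  let (e' , e'∈M , touch) = ∈-endpointList⁻ M x∈ in e' , there e'∈M , touch

endpoint : ∀ {n} → Bool → Edge n → Fin n
endpoint true = proj₁
endpoint false = proj₂

touches-endpoint : ∀ {n} b (e : Edge n) → Touches (endpoint b e) e
touches-endpoint true e = inj₁ refl
touches-endpoint false e = inj₂ refl

edgeOf : ∀ {A : Set} {n} → (A → Bool → Fin n) → A → Edge n
edgeOf end p = end p true , end p false

endpointList-edgeOf : ∀ {A : Set} {n} (end : A → Bool → Fin n) (ps : List A)
  → endpointList (map (edgeOf end) ps) ≡ cartesianProductWith end ps (true ∷ false ∷ [])
endpointList-edgeOf end [] = refl
endpointList-edgeOf end (p ∷ ps) = cong (λ es → end p true ∷ end p false ∷ es) (endpointList-edgeOf end ps)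

edgeOf-endpoints-unique : ∀ {A : Set} {n} (end : A → Bool → Fin n)
  → (∀ {p q b c} → end p b ≡ end q c → p ≡ q × b ≡ c)
  → ∀ {ps} → Unique ps → Unique (endpointList (map (edgeOf end) ps))
edgeOf-endpoints-unique end end-injective {ps} ps-unique = subst Unique (sym (endpointList-edgeOf end ps))
  (Unique.cartesianProductWith⁺ end end-injective ps-unique (((λ ()) ∷ []) ∷ [] ∷ []))

endpoint-injective : ∀ {N r t} (G : RSGraph N r t) s {a a' b b'}
  → endpoint b (RSGraph.edge G s a) ≡ endpoint b' (RSGraph.edge G s a') → a ≡ a' × b ≡ b'
endpoint-injective G s {a} {a'} {b} {b'} same with a ≟ᶠ a'
... | yes refl = refl , side b b' same
  where
  side : ∀ b b' → endpoint b (RSGraph.edge G s a) ≡ endpoint b' (RSGraph.edge G s a) → b ≡ b'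
  side true true _ = refl
  side false false _ = refl
  side true false loop = ⊥-elim (RSGraph.noLoop G s a loop)
  side false true loop = ⊥-elim (RSGraph.noLoop G s a (sym loop))
... | no a≢a' = ⊥-elim (RSGraph.matching G s a a' a≢a' _ (touches-endpoint b _)
                         (subst (λ x → Touches x (RSGraph.edge G s a')) (sym same) (touches-endpoint b' _)))

r≤2*[r∸r/2] : ∀ r → r ≤ 2 * (r ∸ r / 2)
r≤2*[r∸r/2] r = begin
  r                         ≡⟨ m∸n+n≡m (m/n≤m r 2) ⟨
  (r ∸ r / 2) + r / 2       ≤⟨ +-monoʳ-≤ (r ∸ r / 2) half≤rest ⟩
  (r ∸ r / 2) + (r ∸ r / 2) ≡⟨ cong ((r ∸ r / 2) +_) (+-identityʳ _) ⟨
  2 * (r ∸ r / 2)           ∎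
  where
  open ≤-Reasoning
  half≤rest : r / 2 ≤ r ∸ r / 2
  half≤rest = m+n≤o⇒m≤o∸n (r / 2)
    (subst (_≤ r) (trans (*-comm (r / 2) 2) (cong (r / 2 +_) (+-identityʳ _))) (m/n*n≤m r 2))

module HardInstanceBounds {N r t k : ℕ} (H : HardInstance N r t k) where
  open HardInstance H

  edgeᵢ : Fin k → Fin t → Fin r → Edge N
  edgeᵢ i = RSGraph.edge (rs i)

  -- membership in V_i^* and goodness are decidable (finite searches), so the
  -- endpoints of a matching can be split into good and non-good ones
  Star? : ∀ i j → Dec (Star H i j)
  Star? i j = any? (λ a → (j ≟ᶠ proj₁ (edgeᵢ i (chosen i) a)) ⊎-dec (j ≟ᶠ proj₂ (edgeᵢ i (chosen i) a)))

  Good? : Decidable (Good H)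
  Good? x = any? (λ i → any? (λ j → Star? i j ×-dec (label H i j ≟ᶠ x)))

  position : Fin (k * N) → ℕ
  position x = toℕ (Surjection.to⁻ (Bijection.surjection π) x)

  position-injective : ∀ {x y} → position x ≡ position y → x ≡ y
  position-injective {x} {y} eq = begin
    x                  ≡⟨ to∘to⁻ x ⟨
    Bijection.to π _   ≡⟨ cong (Bijection.to π) (toℕ-injective eq) ⟩
    Bijection.to π _   ≡⟨ to∘to⁻ y ⟩
    y                  ∎
    where
    open ≡-Reasoning
    to∘to⁻ = Surjection.to∘to⁻ (Bijection.surjection π)

  position-label : ∀ i j → position (label H i j) ≡ toℕ (idx i j)
  position-label i j = cong toℕ (Bijection.injective π (Surjection.to∘to⁻ (Bijection.surjection π) (label H i j)))

  endpoint-label : ∀ {x e} → IsEdge H e → Touches x e → ∃₂ λ i j → label H i j ≡ x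
  endpoint-label (i , s , a , _ , inj₁ (refl , refl)) (inj₁ refl) = i , _ , refl
  endpoint-label (i , s , a , _ , inj₁ (refl , refl)) (inj₂ refl) = i , _ , refl
  endpoint-label (i , s , a , _ , inj₂ (refl , refl)) (inj₁ refl) = i , _ , refl
  endpoint-label (i , s , a , _ , inj₂ (refl , refl)) (inj₂ refl) = i , _ , refl

  not-good-position : ∀ {x e} → IsEdge H e → Touches x e → ¬ Good H x → position x < N
  not-good-position e∈G touch not-good with endpoint-label e∈G touch
  ... | i , j , refl with Star? i j
  ...   | yes star = ⊥-elim (not-good (i , j , star , refl))
  ...   | no not-star = subst (_< N) (sym (trans (position-label i j) (idx-nonstar i j not-star))) (toℕ<n j)

  trivial-matching-size : ∀ M → IsMatching H M → IsTrivial H M → length M ≤ N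
  trivial-matching-size M (M⊆G , endpoints-unique) trivial = *-cancelˡ-≤ 2 (begin
    2 * length M                                  ≡⟨ length-endpointList M ⟨
    length (endpointList M)                       ≡⟨ length-filter-split Good? (endpointList M) ⟨
    length goodEnds + length otherEnds            ≤⟨ +-mono-≤ good-bound other-bound ⟩
    N + N                                         ≡⟨ cong (N +_) (+-identityʳ N) ⟨
    2 * N                                         ∎)
    where
    open ≤-Reasoning
    goodEnds otherEnds : List (Fin (k * N))
    goodEnds = filter Good? (endpointList M)
    otherEnds = filter (∁? Good?) (endpointList M)
    good-bound : length goodEnds ≤ N
    good-bound = trivial goodEnds (Unique.filter⁺ Good? endpoints-unique)
      (All.tabulate λ x∈ → let (x∈M , good) = ∈-filter⁻ Good? x∈ in good , x∈M)
    other-position : ∀ {p} → p ∈ map position otherEnds → p ∈ upTo N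
    other-position p∈ with ∈-map⁻ position p∈
    ... | x , x∈ , refl with ∈-filter⁻ (∁? Good?) x∈
    ...   | x∈M , not-good with ∈-endpointList⁻ M x∈M
    ...     | e , e∈M , touch = ∈-upTo⁺ (not-good-position (All.lookup M⊆G e∈M) touch not-good)
    other-bound : length otherEnds ≤ N
    other-bound = begin
      length otherEnds                ≡⟨ length-map position otherEnds ⟨
      length (map position otherEnds) ≤⟨ unique-⊆-length
                                           (Unique.map⁺ position-injective (Unique.filter⁺ (∁? Good?) endpoints-unique))
                                           (All.tabulate other-position) ⟩
      length (upTo N)                 ≡⟨ length-upTo N ⟩
      N                               ∎

  blocks-disjoint : ∀ {i i' j j'} → toℕ i < toℕ i' → Star H i j → Star H i' j' → idx i j ≢ idx i' j'
  blocks-disjoint {i} {i'} {j} {j'} i<i' star star' eq = <⇒≱ (proj₂ (idx-star i j star)) (begin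
    N + 2 * r * suc (toℕ i) ≤⟨ +-monoʳ-≤ N (*-monoʳ-≤ (2 * r) i<i') ⟩
    N + 2 * r * toℕ i'      ≤⟨ proj₁ (idx-star i' j' star') ⟩
    toℕ (idx i' j')         ≡⟨ cong toℕ eq ⟨
    toℕ (idx i j)           ∎)
    where open ≤-Reasoning

  -- Distinct vertices of the sets V_i^* receive distinct labels: the blocks are
  -- disjoint, idx is injective inside one block, and π is a bijection.
  star-label-injective : ∀ {i i' j j'} → Star H i j → Star H i' j'
    → label H i j ≡ label H i' j' → i ≡ i' × j ≡ j'
  star-label-injective {i} {i'} {j} {j'} star star' same with <-cmp (toℕ i) (toℕ i')
  ... | tri< i<i' _ _ = ⊥-elim (blocks-disjoint i<i' star star' (Bijection.injective π same))
  ... | tri> _ _ i'<i = ⊥-elim (blocks-disjoint i'<i star' star (sym (Bijection.injective π same)))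
  ... | tri≈ _ i≡i' _ with toℕ-injective i≡i'
  ...   | refl = refl , idx-star-inj i j j' star star' (Bijection.injective π same)

  chosenEnd : Fin k × Fin r → Bool → Fin (k * N)
  chosenEnd (i , a) b = label H i (endpoint b (edgeᵢ i (chosen i) a))

  chosenEnd-injective : ∀ {p q b c} → chosenEnd p b ≡ chosenEnd q c → p ≡ q × b ≡ c
  chosenEnd-injective {i , a} {i' , a'} {b} {c} same
    with star-label-injective (a , touches-endpoint b _) (a' , touches-endpoint c _) same
  ... | refl , same-end with endpoint-injective (rs i) (chosen i) {a} {a'} {b} {c} same-end
  ...   | refl , b≡c = refl , b≡c

  keptPairs : List (Fin k × Fin r)
  keptPairs = pairs (allFin k) (λ i → elements (kept i (chosen i)))

  chosenMatching : List (Edge (k * N))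
  chosenMatching = map (edgeOf chosenEnd) keptPairs

  chosenMatching-isMatching : IsMatching H chosenMatching
  chosenMatching-isMatching = AllP.map⁺ (All.tabulate in-G) , edgeOf-endpoints-unique chosenEnd chosenEnd-injective
    (pairs-unique (Unique.allFin⁺ k) (λ i → elements-unique (kept i (chosen i))))
    where
    in-G : ∀ {p} → p ∈ keptPairs → IsEdge H (edgeOf chosenEnd p)
    in-G {i , a} p∈ = i , chosen i , a , ∈-elements⁻ _ (proj₂ (∈-pairs⁻ (allFin k) p∈)) , inj₁ (refl , refl)

  length-chosenMatching : length chosenMatching ≡ k * (r ∸ r / 2)
  length-chosenMatching = begin
    length chosenMatching           ≡⟨ length-map _ keptPairs ⟩
    length keptPairs                ≡⟨ length-pairs (allFin k) {λ i → elements (kept i (chosen i))} (λ i → trans (length-elements (kept i (chosen i))) (keptSize i (chosen i))) ⟩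
    length (allFin k) * (r ∸ r / 2) ≡⟨ cong (_* (r ∸ r / 2)) (length-tabulate {n = k} (λ x → x)) ⟩
    k * (r ∸ r / 2)                 ∎
    where open ≡-Reasoning

  maximum-matching-size : ∀ Mstar → IsMaximumMatching H Mstar → k * r ≤ 2 * length Mstar
  maximum-matching-size Mstar (_ , maximum) = begin
    k * r                        ≤⟨ *-monoʳ-≤ k (r≤2*[r∸r/2] r) ⟩
    k * (2 * (r ∸ r / 2))        ≡⟨ x∙yz≈y∙xz k 2 (r ∸ r / 2) ⟩
    2 * (k * (r ∸ r / 2))        ≡⟨ cong (2 *_) length-chosenMatching ⟨
    2 * length chosenMatching    ≤⟨ *-monoʳ-≤ 2 (maximum chosenMatching chosenMatching-isMatching) ⟩
    2 * length Mstar             ∎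
    where open ≤-Reasoning

claim3 : ∀ (N r t k : ℕ) (H : HardInstance N r t k) (Mstar M : List (Edge (k * N)))
         → IsMaximumMatching H Mstar → IsMatching H M → IsTrivial H M
         → length M * (k * r) ≤ 4 * N * length Mstar
claim3 N r t k H Mstar M Mstar-maximum M-matching M-trivial = begin
  length M * (k * r)     ≤⟨ *-monoˡ-≤ (k * r) (trivial-matching-size M M-matching M-trivial) ⟩
  N * (k * r)            ≤⟨ *-monoʳ-≤ N (maximum-matching-size Mstar Mstar-maximum) ⟩
  N * (2 * length Mstar) ≤⟨ *-monoʳ-≤ N (*-monoˡ-≤ (length Mstar) {2} {4} (s≤s (s≤s z≤n))) ⟩
  N * (4 * length Mstar) ≡⟨ *-assoc N 4 (length Mstar) ⟨
  N * 4 * length Mstar   ≡⟨ cong (_* length Mstar) (*-comm N 4) ⟩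
  4 * N * length Mstar   ∎
  where
  open ≤-Reasoning
  open HardInstanceBounds H
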